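{- Let $n$ be a positive integer. In any play of the Fibonacci Quilt Game on $n$, the move of Rule (2a), $q_1,q_5\to q_2,q_4$, is made at most once.
   Context: Let $(q_i)_{i\ge1}$ be the Fibonacci Quilt sequence: $q_1=1,q_2=2,q_3=3,q_4=4$ and $q_i=q_{i-3}+q_{i-2}$ for $i\ge5$ (so $q_5=5,q_6=7,q_7=9,q_8=12,q_9=16,q_{10}=21,\dots$). The Fibonacci Quilt Game on $n$: a position is a finite multiset of terms $q_i$ (recorded by their indices); the initial position is $n$ copies of $q_1$. A move replaces two elements of the current multiset (with multiplicity) by one or two elements according to one of the following rules: (1a) $q_1,q_2\to q_3$; (1b) for $i\ge2$, $q_i,q_{i+1}\to q_{i+3}$; (2a) $q_1,q_5\to q_2,q_4$, allowed only if no other move is possible in the current position; (2b) for $i\ge2$, $q_i,q_{i+4}\to q_{i+5}$; (3a) $q_1,q_1\to q_2$; (3b) $q_2,q_2\to q_4$; (3c) $q_3,q_3\to q_2,q_4$; (3d) $q_4,q_4\to q_1,q_6$ or $q_4,q_4\to q_3,q_5$ (player's choice); (3e) $q_5,q_5\to q_1,q_7$; (3f) $q_6,q_6\to q_2,q_8$ or $q_6,q_6\to q_3,q_7$ (player's choice); (3g) for $i\ge7$, $q_i,q_i\to q_{i-5},q_{i+2}$; (4a) for $i=1,2$, $q_i,q_{i+3}\to q_{i+4}$; (4b) $q_3,q_6\to q_1,q_7$; (4c) for $i=4,5$, $q_i,q_{i+3}\to q_1,q_{i+4}$; (4d) $q_6,q_9\to q_2,q_{10}$; (4e) for $i\ge7$,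 $q_i,q_{i+3}\to q_{i-5},q_{i+4}$; (5) $q_1,q_3\to q_4$. The game ends when no move is possible. -}

module Defs where

open import Data.Nat using (ℕ; zero; suc; _+_; _∸_; _≤_; _≥_)
open import Data.List using (List; []; _∷_; _++_; replicate)
open import Data.Product using (∃; ∃-syntax; _×_)
open import Relation.Nullary using (¬_)
open import Data.List.Relation.Binary.Permutation.Propositional using (_↭_)

-- A position is a finite multiset of indices i (standing for q_i, 1-based),
-- represented as a list considered up to permutation (_↭_).
Position : Set
Position = List ℕ

initial : ℕ → Position
initial n = replicate n 1

-- Rule a b outs : the two elements q_a, q_b may be replaced by the elements
-- listed in outs, by one of the rules OTHER than (2a).
data Rule : ℕ → ℕ → List ℕ → Set where
  r1a  : Rule 1 2 (3 ∷ [])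
  r1b  : ∀ i → i ≥ 2 → Rule i (suc i) (i + 3 ∷ [])
  r2b  : ∀ i → i ≥ 2 → Rule i (i + 4) (i + 5 ∷ [])
  r3a  : Rule 1 1 (2 ∷ [])
  r3b  : Rule 2 2 (4 ∷ [])
  r3c  : Rule 3 3 (2 ∷ 4 ∷ [])
  r3d₁ : Rule 4 4 (1 ∷ 6 ∷ [])
  r3d₂ : Rule 4 4 (3 ∷ 5 ∷ [])
  r3e  : Rule 5 5 (1 ∷ 7 ∷ [])
  r3f₁ : Rule 6 6 (2 ∷ 8 ∷ [])
  r3f₂ : Rule 6 6 (3 ∷ 7 ∷ [])
  r3g  : ∀ i → i ≥ 7 → Rule i i (i ∸ 5 ∷ i + 2 ∷ [])
  r4a₁ : Rule 1 4 (5 ∷ [])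
  r4a₂ : Rule 2 5 (6 ∷ [])
  r4b  : Rule 3 6 (1 ∷ 7 ∷ [])
  r4c₁ : Rule 4 7 (1 ∷ 8 ∷ [])
  r4c₂ : Rule 5 8 (1 ∷ 9 ∷ [])
  r4d  : Rule 6 9 (2 ∷ 10 ∷ [])
  r4e  : ∀ i → i ≥ 7 → Rule i (i + 3) (i ∸ 5 ∷ i + 4 ∷ [])
  r5   : Rule 1 3 (4 ∷ [])

OrdinaryMove : Position → Position → Set
OrdinaryMove p p′ =
  ∃[ a ] ∃[ b ] ∃[ outs ] ∃[ rest ]
    (Rule a b outs × p ↭ a ∷ b ∷ rest × p′ ↭ outs ++ rest)

Move2a : Position → Position → Set
Move2a p p′ =
  (∀ q → ¬ OrdinaryMove p q) ×
  ∃[ rest ] (p ↭ 1 ∷ 5 ∷ rest × p′ ↭ 2 ∷ 4 ∷ rest)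

data Play : Position → Position → ℕ → Set where
  done : ∀ {p} → Play p p 0
  ordinary : ∀ {p p′ p″ k} → OrdinaryMove p p′ → Play p′ p″ k → Play p p″ k
  twoA : ∀ {p p′ p″ k} → Move2a p p′ → Play p′ p″ k → Play p p″ (suc k)

-- Rule (2a) q_1, q_5 → q_2, q_4 may only be played when no other move is
-- possible.  At that moment every other index is isolated (q_7 or at least
-- q_10) and no two of them combine, so afterwards the position is q_2, q_4
-- plus pairwise "far" indices (distance 2 or at least 5).  The only move is
-- then q_4, q_7 → q_1, q_8, after which every position consists of a small
-- part (q_1, q_2 or q_3) and a "carry" c with further large indices M
-- satisfying the invariant Good c M: the indices of M are far apart, lie at
-- least 9 below c or above c, and at most one of them can combine with c.
-- Every move is q_1, q_2 → q_3 or the carry absorbing one index of M, which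
-- preserves the invariant.  All indices then differ from 5, so (2a) never
-- becomes available again.

module Submission where

open import Defs
open import Data.Nat using (ℕ; zero; suc; _+_; _∸_; _≤_; _≥_; _<_; z≤n; s≤s; _<ᵇ_)
open import Data.Nat.Properties
open import Data.Nat.Tactic.RingSolver using (solve-∀)
open import Data.Bool using (Bool; true; false; T)
open import Data.List using (List; []; _∷_; _++_)
open import Data.List.Relation.Unary.All as All using (All; []; _∷_)
import Data.List.Relation.Unary.All.Properties as AllP
open import Data.List.Relation.Unary.Any using (here; there)
open import Data.List.Membership.Propositional using (_∈_)
open import Data.List.Membership.Propositional.Properties using (∈-∃++; ∈-++⁻)
open import Data.List.Relation.Binary.Permutation.Propositional
  using (_↭_; prep; swap; ↭-refl; ↭-sym; ↭-trans)
open import Data.List.Relation.Binary.Permutation.Propositional.Properties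
  using (All-resp-↭; ∈-resp-↭; ↭-length; ↭-singleton-inv; drop-∷; shift; shifts; ++⁺ˡ; ++⁺ʳ)
open import Data.Product using (∃-syntax; _×_; _,_; proj₁; proj₂)
open import Data.Sum using (_⊎_; inj₁; inj₂)
import Data.Sum as Sum
open import Data.Empty using (⊥; ⊥-elim)
open import Data.Unit using (tt)
open import Relation.Nullary using (¬_)
open import Relation.Binary.PropositionalEquality using (_≡_; _≢_; refl; sym; trans; cong; subst)

≤-refute : ∀ {m n} → m ≤ n → T (n <ᵇ m) → ⊥
≤-refute {m} {n} m≤n n<m = <⇒≱ (<ᵇ⇒< n m n<m) m≤n

-- m ≤ n exhibits n as m plus an offset (computed structurally, so that
-- matching on the equation instantiates n).
≤-offset : ∀ {m n} → m ≤ n → ∃[ k ] m + k ≡ n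
≤-offset {n = n} z≤n = n , refl
≤-offset (s≤s m≤n) with k , refl ← ≤-offset m≤n = k , refl

-- isGap d: two indices x, y ≥ 7 at distance d admit no rule, since every
-- such rule pairs q_x with q_x, q_{x+1}, q_{x+3} or q_{x+4}.
isGap : ℕ → Bool
isGap 2                               = true
isGap (suc (suc (suc (suc (suc _))))) = true
isGap _                               = false

farB : ℕ → ℕ → Bool
farB zero    y       = isGap y
farB (suc x) zero    = isGap (suc x)
farB (suc x) (suc y) = farB x y

Far : ℕ → ℕ → Set
Far x y = T (farB x y)

farB-sym : ∀ x y → farB x y ≡ farB y x
farB-sym zero    zero    = refl
farB-sym zero    (suc y) = refl
farB-sym (suc x) zero    = refl
farB-sym (suc x) (suc y) = farB-sym x y

Far-sym : ∀ {x y} → Far x y → Far y x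
Far-sym {x} {y} = subst T (farB-sym x y)

farB-shift : ∀ c x y → farB (c + x) (c + y) ≡ farB x y
farB-shift zero    x y = refl
farB-shift (suc c) x y = farB-shift c x y

farB-offset : ∀ x d → farB x (x + d) ≡ isGap d
farB-offset zero    d = refl
farB-offset (suc x) d = farB-offset x d

farB-offset-suc : ∀ x d → farB (suc x) (x + suc d) ≡ isGap d
farB-offset-suc zero    d = refl
farB-offset-suc (suc x) d = farB-offset-suc x d

far-offset : ∀ x d → T (isGap d) → Far x (x + d)
far-offset x d = subst T (sym (farB-offset x d))

¬far-self : ∀ x → ¬ Far x x
¬far-self zero    ()
¬far-self (suc x) = ¬far-self x

¬far-suc : ∀ x → ¬ Far x (suc x)
¬far-suc zero    ()
¬far-suc (suc x) = ¬far-suc x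

-- The rules available to a pair of indices x ≤ y with x ≥ 7: y lies at
-- distance 0, 1, 3 or 4 above x.
data LargeRule (x : ℕ) : ℕ → List ℕ → Set where
  same  : LargeRule x x (x ∸ 5 ∷ x + 2 ∷ [])
  next  : LargeRule x (suc x) (x + 3 ∷ [])
  skip3 : LargeRule x (x + 3) (x ∸ 5 ∷ x + 4 ∷ [])
  skip4 : LargeRule x (x + 4) (x + 5 ∷ [])

large-rule : ∀ {x y o} → 7 ≤ x → Rule x y o → LargeRule x y o
large-rule _ (r1b _ _) = next
large-rule _ (r2b _ _) = skip4
large-rule _ (r3g _ _) = same
large-rule _ (r4e _ _) = skip3
large-rule p r1a  = ⊥-elim (≤-refute p tt)
large-rule p r3a  = ⊥-elim (≤-refute p tt)
large-rule p r3b  = ⊥-elim (≤-refute p tt)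
large-rule p r3c  = ⊥-elim (≤-refute p tt)
large-rule p r3d₁ = ⊥-elim (≤-refute p tt)
large-rule p r3d₂ = ⊥-elim (≤-refute p tt)
large-rule p r3e  = ⊥-elim (≤-refute p tt)
large-rule p r3f₁ = ⊥-elim (≤-refute p tt)
large-rule p r3f₂ = ⊥-elim (≤-refute p tt)
large-rule p r4a₁ = ⊥-elim (≤-refute p tt)
large-rule p r4a₂ = ⊥-elim (≤-refute p tt)
large-rule p r4b  = ⊥-elim (≤-refute p tt)
large-rule p r4c₁ = ⊥-elim (≤-refute p tt)
large-rule p r4c₂ = ⊥-elim (≤-refute p tt)
large-rule p r4d  = ⊥-elim (≤-refute p tt)
large-rule p r5   = ⊥-elim (≤-refute p tt)

large-rule-≤ : ∀ {x y o} → LargeRule x y o → x ≤ y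
large-rule-≤ {x} same  = ≤-refl
large-rule-≤ {x} next  = n≤1+n x
large-rule-≤ {x} skip3 = m≤m+n x 3
large-rule-≤ {x} skip4 = m≤m+n x 4

large-rule-¬far : ∀ {x y o} → LargeRule x y o → ¬ Far x y
large-rule-¬far {x} same  = ¬far-self x
large-rule-¬far {x} next  = ¬far-suc x
large-rule-¬far {x} skip3 = subst T (farB-offset x 3)
large-rule-¬far {x} skip4 = subst T (farB-offset x 4)

no-rule-far : ∀ {x y o} → 7 ≤ x → Far x y → ¬ Rule x y o
no-rule-far p f r = large-rule-¬far (large-rule p r) f

no-rule-down : ∀ {x y o} → 7 ≤ x → y < x → ¬ Rule x y o
no-rule-down p y<x r = <⇒≱ y<x (large-rule-≤ (large-rule p r))

far-or-rule-above : ∀ x d → 7 ≤ x → Far x (x + d) ⊎ ∃[ o ] Rule x (x + d) o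
far-or-rule-above x 0 p = inj₂ (_ , subst (λ y → Rule x y (x ∸ 5 ∷ x + 2 ∷ [])) (sym (+-identityʳ x)) (r3g x p))
far-or-rule-above x 1 p = inj₂ (_ , subst (λ y → Rule x y (x + 3 ∷ [])) (+-comm 1 x) (r1b x (≤-trans (≤ᵇ⇒≤ 2 7 tt) p)))
far-or-rule-above x 2 p = inj₁ (far-offset x 2 tt)
far-or-rule-above x 3 p = inj₂ (_ , r4e x p)
far-or-rule-above x 4 p = inj₂ (_ , r2b x (≤-trans (≤ᵇ⇒≤ 2 7 tt) p))
far-or-rule-above x (suc (suc (suc (suc (suc d))))) p = inj₁ (far-offset x (5 + d) tt)

far-or-rule : ∀ x y → 7 ≤ x → 7 ≤ y →
              Far x y ⊎ (∃[ o ] Rule x y o) ⊎ (∃[ o ] Rule y x o)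
far-or-rule x y px py with ≤-total x y
... | inj₁ x≤y with (d , refl) ← ≤-offset x≤y =
  Sum.map₂ inj₁ (far-or-rule-above x d px)
... | inj₂ y≤x with (d , refl) ← ≤-offset y≤x =
  Sum.map (Far-sym {y}) inj₂ (far-or-rule-above y d py)

small-rule-bound : ∀ {a b o} → Rule a b o → a ≤ 3 → b ≤ a + 4
small-rule-bound r1a       _ = ≤ᵇ⇒≤ _ _ tt
small-rule-bound (r1b i _) _ = subst (suc i ≤_) (+-comm 4 i) (s≤s (m≤n+m i 3))
small-rule-bound (r2b i _) _ = ≤-refl
small-rule-bound r3a       _ = ≤ᵇ⇒≤ _ _ tt
small-rule-bound r3b       _ = ≤ᵇ⇒≤ _ _ tt
small-rule-bound r3c       _ = ≤ᵇ⇒≤ _ _ tt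
small-rule-bound r4a₁      _ = ≤ᵇ⇒≤ _ _ tt
small-rule-bound r4a₂      _ = ≤ᵇ⇒≤ _ _ tt
small-rule-bound r4b       _ = ≤ᵇ⇒≤ _ _ tt
small-rule-bound r5        _ = ≤ᵇ⇒≤ _ _ tt
small-rule-bound (r3g i p) q = ⊥-elim (≤-refute (≤-trans p q) tt)
small-rule-bound (r4e i p) q = ⊥-elim (≤-refute (≤-trans p q) tt)
small-rule-bound r3d₁      q = ⊥-elim (≤-refute q tt)
small-rule-bound r3d₂      q = ⊥-elim (≤-refute q tt)
small-rule-bound r3e       q = ⊥-elim (≤-refute q tt)
small-rule-bound r3f₁      q = ⊥-elim (≤-refute q tt)
small-rule-bound r3f₂      q = ⊥-elim (≤-refute q tt)
small-rule-bound r4c₁      q = ⊥-elim (≤-refute q tt)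
small-rule-bound r4c₂      q = ⊥-elim (≤-refute q tt)
small-rule-bound r4d       q = ⊥-elim (≤-refute q tt)

rule-from-4 : ∀ {y o} → Rule 4 y o → (y ≡ 7 × o ≡ 1 ∷ 8 ∷ []) ⊎ y ≤ 5 ⊎ y ≡ 8
rule-from-4 (r1b _ _)        = inj₂ (inj₁ ≤-refl)
rule-from-4 (r2b _ _)        = inj₂ (inj₂ refl)
rule-from-4 r3d₁             = inj₂ (inj₁ (≤ᵇ⇒≤ _ _ tt))
rule-from-4 r3d₂             = inj₂ (inj₁ (≤ᵇ⇒≤ _ _ tt))
rule-from-4 r4c₁             = inj₁ (refl , refl)
rule-from-4 (r3g _ p)        = ⊥-elim (≤-refute p tt)
rule-from-4 (r4e _ p)        = ⊥-elim (≤-refute p tt)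

rule-1-2 : ∀ {o} → Rule 1 2 o → o ≡ 3 ∷ []
rule-1-2 r1a         = refl
rule-1-2 (r1b 1 2≤1) = ⊥-elim (≤-refute 2≤1 tt)

no-rule-2-1 : ∀ {o} → ¬ Rule 2 1 o
no-rule-2-1 ()

no-rule-2-4 : ∀ {o} → ¬ Rule 2 4 o
no-rule-2-4 ()

no-rule-4-2 : ∀ {o} → ¬ Rule 4 2 o
no-rule-4-2 ()

positive+ : ∀ i k → 1 ≤ i + suc k
positive+ i k = ≤-trans (s≤s z≤n) (m≤n+m (suc k) i)

positive∸5 : ∀ {i} → 7 ≤ i → 1 ≤ i ∸ 5
positive∸5 p = ≤-trans (s≤s z≤n) (∸-monoˡ-≤ 5 p)

rule-outputs-positive : ∀ {a b o} → Rule a b o → All (1 ≤_) o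
rule-outputs-positive (r1b i _) = positive+ i 2 ∷ []
rule-outputs-positive (r2b i _) = positive+ i 4 ∷ []
rule-outputs-positive (r3g i p) = positive∸5 p ∷ positive+ i 1 ∷ []
rule-outputs-positive (r4e i p) = positive∸5 p ∷ positive+ i 3 ∷ []
rule-outputs-positive r1a  = s≤s z≤n ∷ []
rule-outputs-positive r3a  = s≤s z≤n ∷ []
rule-outputs-positive r3b  = s≤s z≤n ∷ []
rule-outputs-positive r3c  = s≤s z≤n ∷ s≤s z≤n ∷ []
rule-outputs-positive r3d₁ = s≤s z≤n ∷ s≤s z≤n ∷ []
rule-outputs-positive r3d₂ = s≤s z≤n ∷ s≤s z≤n ∷ []
rule-outputs-positive r3e  = s≤s z≤n ∷ s≤s z≤n ∷ []
rule-outputs-positive r3f₁ = s≤s z≤n ∷ s≤s z≤n ∷ []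
rule-outputs-positive r3f₂ = s≤s z≤n ∷ s≤s z≤n ∷ []
rule-outputs-positive r4a₁ = s≤s z≤n ∷ []
rule-outputs-positive r4a₂ = s≤s z≤n ∷ []
rule-outputs-positive r4b  = s≤s z≤n ∷ s≤s z≤n ∷ []
rule-outputs-positive r4c₁ = s≤s z≤n ∷ s≤s z≤n ∷ []
rule-outputs-positive r4c₂ = s≤s z≤n ∷ s≤s z≤n ∷ []
rule-outputs-positive r4d  = s≤s z≤n ∷ s≤s z≤n ∷ []
rule-outputs-positive r5   = s≤s z≤n ∷ []

extract : ∀ {x : ℕ} {xs} → x ∈ xs → ∃[ xs' ] xs ↭ x ∷ xs'
extract x∈xs with ys , zs , refl ← ∈-∃++ x∈xs = ys ++ zs , shift _ ys zs

take : ∀ s B {x rest} → s ++ B ↭ x ∷ rest →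
       (∃[ s' ] s ↭ x ∷ s' × rest ↭ s' ++ B) ⊎ (∃[ B' ] B ↭ x ∷ B' × rest ↭ s ++ B')
take s B {x} P with ∈-++⁻ s (∈-resp-↭ (↭-sym P) (here refl))
... | inj₁ x∈s with s' , S ← extract x∈s =
  inj₁ (s' , S , drop-∷ (↭-trans (↭-sym P) (++⁺ʳ B S)))
... | inj₂ x∈B with B' , Q ← extract x∈B =
  inj₂ (B' , Q , drop-∷ (↭-trans (↭-sym P) (↭-trans (++⁺ˡ s Q) (shift x s B'))))

data Pick (s B : List ℕ) (a b : ℕ) (rest : List ℕ) : Set where
  both-left  : ∀ {s'}    → s ↭ a ∷ b ∷ s' → rest ↭ s' ++ B → Pick s B a b rest
  left-right : ∀ {s' B'} → s ↭ a ∷ s' → B ↭ b ∷ B' → rest ↭ s' ++ B' → Pick s B a b rest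
  right-left : ∀ {s' B'} → B ↭ a ∷ B' → s ↭ b ∷ s' → rest ↭ s' ++ B' → Pick s B a b rest
  both-right : ∀ {B'}    → B ↭ a ∷ b ∷ B' → rest ↭ s ++ B' → Pick s B a b rest

pick : ∀ s B {a b rest} → s ++ B ↭ a ∷ b ∷ rest → Pick s B a b rest
pick s B {a} P with take s B P
... | inj₁ (s' , S , R) with take s' B (↭-sym R)
...   | inj₁ (s'' , S' , R') = both-left (↭-trans S (prep a S')) R'
...   | inj₂ (B' , Q , R')   = left-right S Q R'
pick s B {a} P | inj₂ (B' , Q , R) with take s B' (↭-sym R)
...   | inj₁ (s' , S , R')   = right-left Q S R'
...   | inj₂ (B'' , Q' , R') = both-right (↭-trans Q (prep a Q')) R'

singleton-take : ∀ {x a : ℕ} {s} → x ∷ [] ↭ a ∷ s → a ≡ x × s ≡ []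
singleton-take P with refl ← ↭-singleton-inv (↭-sym P) = refl , refl

singleton-take₂ : ∀ {x a b : ℕ} {s} → ¬ (x ∷ [] ↭ a ∷ b ∷ s)
singleton-take₂ P with ↭-length P
... | ()

pair-take : ∀ {x y a : ℕ} {s} → x ∷ y ∷ [] ↭ a ∷ s →
            (a ≡ x × s ≡ y ∷ []) ⊎ (a ≡ y × s ≡ x ∷ [])
pair-take {x} {y} P with ∈-resp-↭ (↭-sym P) (here refl)
... | here refl = inj₁ (refl , ↭-singleton-inv (↭-sym (drop-∷ P)))
... | there (here refl) =
  inj₂ (refl , ↭-singleton-inv (↭-sym (drop-∷ (↭-trans (swap y x ↭-refl) P))))

all-from-front : ∀ {P : ℕ → Set} {M} → (∀ {x rs} → M ↭ x ∷ rs → P x) → All P M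
all-from-front f = All.tabulate (λ x∈M → f (proj₂ (extract x∈M)))

all-take : ∀ {P : ℕ → Set} {M a M'} → All P M → M ↭ a ∷ M' → P a × All P M'
all-take all P with All-resp-↭ P all
... | pa ∷ rest = pa , rest

all-front : ∀ {P : ℕ → Set} {M x rs} → All P M → M ↭ x ∷ rs → P x
all-front all P = proj₁ (all-take all P)

EveryPair : (ℕ → ℕ → Set) → List ℕ → Set
EveryPair R M = ∀ {x y rs} → M ↭ x ∷ y ∷ rs → R x y

every-pair-drop : ∀ {R M a M'} → EveryPair R M → M ↭ a ∷ M' → EveryPair R M'
every-pair-drop {a = a} w P Q =
  w (↭-trans P (↭-trans (prep a Q) (↭-trans (swap a _ ↭-refl) (prep _ (swap a _ ↭-refl)))))

every-pair-with : ∀ {R M a M' x rs} → EveryPair R M → M ↭ a ∷ M' → M' ↭ x ∷ rs → R a x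
every-pair-with {a = a} w P Q = w (↭-trans P (prep a Q))

every-pair-with′ : ∀ {R M a M' x rs} → EveryPair R M → M ↭ a ∷ M' → M' ↭ x ∷ rs → R x a
every-pair-with′ {a = a} {x = x} w P Q = w (↭-trans P (↭-trans (prep a Q) (swap a x ↭-refl)))

every-pair-cons : ∀ {R a M'} → EveryPair R M' →
                  (∀ {x rs} → M' ↭ x ∷ rs → R a x × R x a) → EveryPair R (a ∷ M')
every-pair-cons {a = a} {M'} w f P with pick (a ∷ []) M' P
... | both-left S _ = ⊥-elim (singleton-take₂ S)
... | left-right S Q _ with refl , _ ← singleton-take S = proj₁ (f Q)
... | right-left Q S _ with refl , _ ← singleton-take S = proj₂ (f Q)
... | both-right Q _ = w Q

-- Position of an index m of M relative to the carry c: at least 9 below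
-- c, or above c and then at least 12 (which excludes 9, 10, 11 above the
-- first carry 8).
data Placed (c m : ℕ) : Set where
  below : (e : ℕ) → c ≡ m + 9 + e → 8 ≤ m → Placed c m
  above : (j : ℕ) → m ≡ c + suc j → 12 ≤ m → Placed c m

-- The window c+1, …, c+4 of indices that could combine with the carry c.
InWindow : ℕ → ℕ → Set
InWindow c x = ∃[ i ] i ≤ 3 × x ≡ c + suc i

NotBothInWindow : ℕ → ℕ → ℕ → Set
NotBothInWindow c x y = ¬ (InWindow c x × InWindow c y)

-- x = c − 9 together with y = c + 3: absorbing y would put c − 5 too close to x.
Straddle : ℕ → ℕ → ℕ → Set
Straddle c x y = c ≡ x + 9 × y ≡ c + 3

record Good (c : ℕ) (M : List ℕ) : Set where
  field
    -- c − 5 ≥ 8 whenever the carry can release c − 5 (rule q_c, q_{c+3}).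
    carry-ok      : c ≡ 8 ⊎ 13 ≤ c
    placed        : All (Placed c) M
    separated     : EveryPair Far M
    one-in-window : EveryPair (NotBothInWindow c) M
    -- Releasing c − 5 keeps the indices below the carry far apart.
    no-straddle   : EveryPair (λ x y → ¬ Straddle c x y) M

Carried : List ℕ → Set
Carried X = ∃[ c ] ∃[ M ] X ↭ c ∷ M × Good c M

carried-resp : ∀ {X Y} → X ↭ Y → Carried X → Carried Y
carried-resp X↭Y (c , M , X↭cM , g) = c , M , ↭-trans (↭-sym X↭Y) X↭cM , g

placed-≥8 : ∀ {c m} → Placed c m → 8 ≤ m
placed-≥8 (below _ _ p) = p
placed-≥8 (above _ _ p) = ≤-trans (≤ᵇ⇒≤ 8 12 tt) p

carry-≥8 : ∀ {c} → c ≡ 8 ⊎ 13 ≤ c → 8 ≤ c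
carry-≥8 (inj₁ refl) = ≤-refl
carry-≥8 (inj₂ p)    = ≤-trans (≤ᵇ⇒≤ 8 13 tt) p

carried-≥8 : ∀ {X} → Carried X → All (8 ≤_) X
carried-≥8 (c , M , X↭cM , g) =
  All-resp-↭ (↭-sym X↭cM) (carry-≥8 (Good.carry-ok g) ∷ All.map placed-≥8 (Good.placed g))

¬placed-self : ∀ c → ¬ Placed c c
¬placed-self c (below e eq _) = m≢1+m+n c (trans eq (trans (+-assoc c 9 e) (+-suc c (8 + e))))
¬placed-self c (above j eq _) = m+1+n≢m c (sym eq)

placed-below-raise : ∀ {c x e} a → c ≡ x + 9 + e → 8 ≤ x → Placed (c + a) x
placed-below-raise {x = x} {e} a refl p = below (e + a) (+-assoc (x + 9) e a) p

placed-above-raise : ∀ c a k → 12 ≤ c + suc (a + k) → Placed (c + a) (c + suc (a + k))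
placed-above-raise c a k p = above k eq p
  where
    eq : c + suc (a + k) ≡ c + a + suc k
    eq = trans (cong (c +_) (sym (+-suc a k))) (sym (+-assoc c a (suc k)))

outside-window : ∀ {c} j → ¬ InWindow c (c + suc j) → ∃[ k ] j ≡ 4 + k
outside-window 0 w = ⊥-elim (w (0 , ≤ᵇ⇒≤ _ _ tt , refl))
outside-window 1 w = ⊥-elim (w (1 , ≤ᵇ⇒≤ _ _ tt , refl))
outside-window 2 w = ⊥-elim (w (2 , ≤ᵇ⇒≤ _ _ tt , refl))
outside-window 3 w = ⊥-elim (w (3 , ≤ᵇ⇒≤ _ _ tt , refl))
outside-window (suc (suc (suc (suc k)))) _ = k , refl

-- Absorbing c + 1 moves the carry to c + 3.
placed-after-next : ∀ {c x} → Placed c x → Far (suc c) x → ¬ InWindow c x → Placed (c + 3) x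
placed-after-next (below e eq p) _ _ = placed-below-raise 3 eq p
placed-after-next {c} (above j refl p) f w with outside-window j w
... | 0     , refl = ⊥-elim (subst T (farB-offset-suc c 4) f)
... | suc k , refl = placed-above-raise c 3 (2 + k) p

-- Absorbing c + 3 moves the carry to c + 4.
placed-after-skip3 : ∀ {c x} → Placed c x → ¬ InWindow c x → Placed (c + 4) x
placed-after-skip3 (below e eq p) _ = placed-below-raise 4 eq p
placed-after-skip3 {c} (above j refl p) w with outside-window j w
... | k , refl = placed-above-raise c 4 k p

-- Absorbing c + 4 moves the carry to c + 5.
placed-after-skip4 : ∀ {c x} → Placed c x → Far (c + 4) x → ¬ InWindow c x → Placed (c + 5) x
placed-after-skip4 (below e eq p) _ _ = placed-below-raise 5 eq p
placed-after-skip4 {c} (above j refl p) f w with outside-window j w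
... | 0     , refl = ⊥-elim (subst T (farB-shift c 4 5) f)
... | suc k , refl = placed-above-raise c 5 k p

no-index-nine-below : ∀ {c x} a → 1 ≤ a → a ≤ 9 → Placed c x → c + a ≢ x + 9
no-index-nine-below {x = x} a 1≤a _ (below e refl _) =
  >⇒≢ (≤-<-trans (m≤m+n (x + 9) e) (m<m+n (x + 9 + e) 1≤a))
no-index-nine-below {c} a _ a≤9 (above j refl _) =
  <⇒≢ (≤-<-trans (+-monoʳ-≤ c a≤9) (+-monoˡ-< 9 (m<m+n c (s≤s z≤n))))

at-most-one-in-window : ∀ {c' M'} (G : ℕ → Set) → (∀ {i j} → G i → G j → ¬ Far i j) →
                        (∀ {i rs} → i ≤ 3 → M' ↭ c' + suc i ∷ rs → G i) →
                        EveryPair Far M' → EveryPair (NotBothInWindow c') M'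
at-most-one-in-window {c'} G no-far offset sep P ((i , i≤3 , refl) , (j , j≤3 , refl)) =
  no-far (offset i≤3 P) (offset j≤3 (↭-trans P (swap _ _ ↭-refl)))
         (subst T (farB-shift c' (suc i) (suc j)) (sep P))

-- The offsets i ≤ 3 such that c' + 1 + i is far from the absorbed index
-- c' − 2 (distance 3 + i), resp. c' − 1 (distance 2 + i); no two of them
-- are far apart.
Offset23 : ℕ → Set
Offset23 i = i ≡ 2 ⊎ i ≡ 3

Offset03 : ℕ → Set
Offset03 i = i ≡ 0 ⊎ i ≡ 3

gap-offset-3 : ∀ {i} → i ≤ 3 → T (isGap (3 + i)) → Offset23 i
gap-offset-3 {2} _ _ = inj₁ refl
gap-offset-3 {3} _ _ = inj₂ refl
gap-offset-3 {suc (suc (suc (suc _)))} i≤3 _ = ⊥-elim (≤-refute i≤3 tt)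

gap-offset-2 : ∀ {i} → i ≤ 3 → T (isGap (2 + i)) → Offset03 i
gap-offset-2 {0} _ _ = inj₁ refl
gap-offset-2 {3} _ _ = inj₂ refl
gap-offset-2 {suc (suc (suc (suc _)))} i≤3 _ = ⊥-elim (≤-refute i≤3 tt)

offsets23-close : ∀ {i j} → Offset23 i → Offset23 j → ¬ Far i j
offsets23-close (inj₁ refl) (inj₁ refl) ()
offsets23-close (inj₁ refl) (inj₂ refl) ()
offsets23-close (inj₂ refl) (inj₁ refl) ()
offsets23-close (inj₂ refl) (inj₂ refl) ()

offsets03-close : ∀ {i j} → Offset03 i → Offset03 j → ¬ Far i j
offsets03-close (inj₁ refl) (inj₁ refl) ()
offsets03-close (inj₁ refl) (inj₂ refl) ()
offsets03-close (inj₂ refl) (inj₁ refl) ()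
offsets03-close (inj₂ refl) (inj₂ refl) ()

no-straddle-below : ∀ {c M} → (∀ {x y rs} → M ↭ x ∷ y ∷ rs → c ≢ x + 9) →
                    EveryPair (λ x y → ¬ Straddle c x y) M
no-straddle-below none P (eq , _) = none P eq

below-≤ : ∀ {c x e} → c ≡ x + 9 + e → x ≤ c
below-≤ {x = x} {e} refl = ≤-trans (m≤m+n x 9) (m≤m+n (x + 9) e)

below-∉-window : ∀ {c x e} → c ≡ x + 9 + e → ¬ InWindow c x
below-∉-window {c} eq (i , _ , refl) = <⇒≱ (m<m+n c (s≤s z≤n)) (below-≤ eq)

placed-above-≥12 : ∀ {c x} → Placed c x → c < x → 12 ≤ x
placed-above-≥12 (below e eq _) c<x = ⊥-elim (<⇒≱ c<x (below-≤ eq))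
placed-above-≥12 (above _ _ p)  _   = p

-- The facts about M' used when the carry c absorbs the index b of M = b ∷ M'.
module Absorb {c b : ℕ} {M M' : List ℕ} (g : Good c M) (M↭ : M ↭ b ∷ M') where
  open Good g

  b-placed : Placed c b
  b-placed = proj₁ (all-take placed M↭)

  placed′ : All (Placed c) M'
  placed′ = proj₂ (all-take placed M↭)

  separated′ : EveryPair Far M'
  separated′ = every-pair-drop separated M↭

  far-from-b : ∀ {x rs} → M' ↭ x ∷ rs → Far b x
  far-from-b = every-pair-with separated M↭

  alone-in-window : InWindow c b → ∀ {x rs} → M' ↭ x ∷ rs → ¬ InWindow c x
  alone-in-window b∈w R x∈w = every-pair-with one-in-window M↭ R (b∈w , x∈w)

  no-straddle-with-b : ∀ {x rs} → M' ↭ x ∷ rs → ¬ Straddle c x b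
  no-straddle-with-b = every-pair-with′ no-straddle M↭

  no-straddle-raised : ∀ a → 1 ≤ a → a ≤ 9 → EveryPair (λ x y → ¬ Straddle (c + a) x y) M'
  no-straddle-raised a 1≤a a≤9 =
    no-straddle-below (λ P → no-index-nine-below a 1≤a a≤9 (all-front placed′ P))

absorb-next : ∀ {c M M'} → Good c M → M ↭ suc c ∷ M' → Good (c + 3) M'
absorb-next {c} {M} {M'} g M↭ = record
  { carry-ok      = carry-ok′ (Good.carry-ok g)
  ; placed        = all-from-front (λ R →
                      placed-after-next (all-front placed′ R) (far-from-b R) (alone-in-window b∈w R))
  ; separated     = separated′
  ; one-in-window = at-most-one-in-window Offset23 offsets23-close offset separated′
  ; no-straddle   = no-straddle-raised 3 (s≤s z≤n) (≤ᵇ⇒≤ 3 9 tt)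
  }
  where
    open Absorb g M↭
    b∈w : InWindow c (suc c)
    b∈w = 0 , z≤n , sym (+-comm c 1)
    carry-ok′ : c ≡ 8 ⊎ 13 ≤ c → c + 3 ≡ 8 ⊎ 13 ≤ c + 3
    carry-ok′ (inj₁ refl) = ⊥-elim (≤-refute (placed-above-≥12 b-placed ≤-refl) tt)
    carry-ok′ (inj₂ p)    = inj₂ (≤-trans p (m≤m+n c 3))
    offset : ∀ {i rs} → i ≤ 3 → M' ↭ c + 3 + suc i ∷ rs → Offset23 i
    offset {i} i≤3 R = gap-offset-3 i≤3
      (subst T (farB-offset-suc c (3 + i)) (subst (Far (suc c)) (+-assoc c 3 (suc i)) (far-from-b R)))

absorb-skip4 : ∀ {c M M'} → Good c M → M ↭ c + 4 ∷ M' → Good (c + 5) M'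
absorb-skip4 {c} {M} {M'} g M↭ = record
  { carry-ok      = carry-ok′ (Good.carry-ok g)
  ; placed        = all-from-front (λ R →
                      placed-after-skip4 (all-front placed′ R) (far-from-b R) (alone-in-window b∈w R))
  ; separated     = separated′
  ; one-in-window = at-most-one-in-window Offset03 offsets03-close offset separated′
  ; no-straddle   = no-straddle-raised 5 (s≤s z≤n) (≤ᵇ⇒≤ 5 9 tt)
  }
  where
    open Absorb g M↭
    b∈w : InWindow c (c + 4)
    b∈w = 3 , ≤-refl , refl
    carry-ok′ : c ≡ 8 ⊎ 13 ≤ c → c + 5 ≡ 8 ⊎ 13 ≤ c + 5
    carry-ok′ (inj₁ refl) = inj₂ ≤-refl
    carry-ok′ (inj₂ p)    = inj₂ (≤-trans p (m≤m+n c 5))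
    offset : ∀ {i rs} → i ≤ 3 → M' ↭ c + 5 + suc i ∷ rs → Offset03 i
    offset {i} i≤3 R = gap-offset-2 i≤3
      (subst T (farB-shift c 4 (5 + suc i)) (subst (Far (c + 4)) (+-assoc c 5 (suc i)) (far-from-b R)))

-- When c = 13 + d absorbs c + 3, the released index c − 5 = 8 + d is far
-- from every other index x: x ≠ c − 9 since x, c + 3 do not straddle c, so x
-- lies at most at c − 10 or above c.
released-far : ∀ d {x} → Placed (13 + d) x → ¬ Straddle (13 + d) x (13 + d + 3) → Far (8 + d) x
released-far d {x} (below 0 eq _) no-straddle = ⊥-elim (no-straddle (trans eq (+-identityʳ (x + 9)) , refl))
released-far d {x} (below (suc e) eq _) _ =
  Far-sym {x} (subst (Far x) (sym lower-gap) (far-offset x (5 + e) tt))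
  where
    shuffle : ∀ x e → x + 9 + suc e ≡ 5 + (x + (5 + e))
    shuffle = solve-∀
    lower-gap : 8 + d ≡ x + (5 + e)
    lower-gap = +-cancelˡ-≡ 5 (8 + d) (x + (5 + e)) (trans eq (shuffle x e))
released-far d (above j refl _) _ =
  subst (Far (8 + d)) (sym (upper-gap d j)) (far-offset (8 + d) (5 + suc j) tt)
  where
    upper-gap : ∀ d j → 13 + d + suc j ≡ 8 + d + (5 + suc j)
    upper-gap = solve-∀

absorb-skip3 : ∀ d {M M'} → Good (13 + d) M → M ↭ 13 + d + 3 ∷ M' → Good (13 + d + 4) (8 + d ∷ M')
absorb-skip3 d {M} {M'} g M↭ = record
  { carry-ok      = inj₂ (≤-trans (m≤m+n 13 d) (m≤m+n (13 + d) 4))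
  ; placed        = below 0 (new-below d) (m≤m+n 8 d)
                    ∷ all-from-front (λ R → placed-after-skip3 (all-front placed′ R) (alone-in-window b∈w R))
  ; separated     = every-pair-cons separated′ (λ {x} R → far-released R , Far-sym {8 + d} {x} (far-released R))
  ; one-in-window = every-pair-cons {R = NotBothInWindow (13 + d + 4)}
                      (at-most-one-in-window {13 + d + 4} Offset03 offsets03-close offset separated′)
                      (λ R → (λ (w , _) → released-∉-window w) , (λ (_ , w) → released-∉-window w))
  ; no-straddle   = every-pair-cons {R = λ x y → ¬ Straddle (13 + d + 4) x y}
                      (no-straddle-raised 4 (s≤s z≤n) (≤ᵇ⇒≤ 4 9 tt))
                      (λ R → (λ (_ , y≡) → no-c+7 R y≡) ,
                             (λ (eq , _) → no-index-nine-below 4 (s≤s z≤n) (≤ᵇ⇒≤ 4 9 tt) (all-front placed′ R) eq))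
  }
  where
    open Absorb g M↭
    c = 13 + d
    b∈w : InWindow c (c + 3)
    b∈w = 2 , ≤ᵇ⇒≤ 2 3 tt , refl
    new-below : ∀ d → 13 + d + 4 ≡ 8 + d + 9 + 0
    new-below = solve-∀
    released-∉-window : ¬ InWindow (c + 4) (8 + d)
    released-∉-window = below-∉-window (new-below d)
    offset : ∀ {i rs} → i ≤ 3 → M' ↭ c + 4 + suc i ∷ rs → Offset03 i
    offset {i} i≤3 R = gap-offset-2 i≤3
      (subst T (farB-shift c 3 (4 + suc i)) (subst (Far (c + 3)) (+-assoc c 4 (suc i)) (far-from-b R)))
    far-released : ∀ {x rs} → M' ↭ x ∷ rs → Far (8 + d) x
    far-released R = released-far d (all-front placed′ R) (no-straddle-with-b R)
    -- c + 7 would be at distance 4 from the absorbed c + 3.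
    no-c+7 : ∀ {y rs} → M' ↭ y ∷ rs → y ≢ c + 4 + 3
    no-c+7 R refl = subst T (farB-offset (c + 3) 4)
      (subst (Far (c + 3)) (trans (+-assoc c 4 3) (sym (+-assoc c 3 4))) (far-from-b R))

-- The carry absorbs an index b of M by a rule on large indices.  The carry
-- 8 cannot absorb 11, which is not placed above it.
absorb : ∀ {c M b M' o} → Good c M → M ↭ b ∷ M' → LargeRule c b o → Carried (o ++ M')
absorb {c} g M↭ same = ⊥-elim (¬placed-self c (Absorb.b-placed g M↭))
absorb {c} {M' = M'} g M↭ next  = c + 3 , M' , ↭-refl , absorb-next g M↭
absorb {c} {M' = M'} g M↭ skip4 = c + 5 , M' , ↭-refl , absorb-skip4 g M↭
absorb {c} {M' = M'} g M↭ skip3 with Good.carry-ok g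
... | inj₁ refl = ⊥-elim (≤-refute (placed-above-≥12 (Absorb.b-placed g M↭) (≤ᵇ⇒≤ 9 11 tt)) tt)
... | inj₂ 13≤c with (d , refl) ← ≤-offset 13≤c =
  13 + d + 4 , 8 + d ∷ M' , swap _ _ ↭-refl , absorb-skip3 d g M↭

8≤⇒7≤ : ∀ {x} → 8 ≤ x → 7 ≤ x
8≤⇒7≤ = ≤-trans (n≤1+n 7)

placed-no-rule : ∀ {c a o} → Placed c a → ¬ Rule a c o
placed-no-rule {a = a} (below e refl p) =
  no-rule-far (8≤⇒7≤ p) (subst (Far a) (sym (+-assoc a 9 e)) (far-offset a (9 + e) tt))
placed-no-rule {c} (above j refl p) =
  no-rule-down (8≤⇒7≤ (placed-≥8 (above {c} j refl p))) (m<m+n c (s≤s z≤n))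

large-move : ∀ {c M a b X' o} → Good c M → c ∷ M ↭ a ∷ b ∷ X' → Rule a b o → Carried (o ++ X')
large-move {c} {M} {o = o} g P r with pick (c ∷ []) M P
... | both-left S _ = ⊥-elim (singleton-take₂ S)
... | left-right S Q R with refl , refl ← singleton-take S =
  carried-resp (++⁺ˡ o (↭-sym R)) (absorb g Q (large-rule (8≤⇒7≤ (carry-≥8 (Good.carry-ok g))) r))
... | right-left Q S _ with refl , refl ← singleton-take S =
  ⊥-elim (placed-no-rule (all-front (Good.placed g) Q) r)
... | both-right Q _ =
  ⊥-elim (no-rule-far (8≤⇒7≤ (placed-≥8 (all-front (Good.placed g) Q))) (Good.separated g Q) r)

-- An index left beside q_1, q_5 when no ordinary move is possible: it has
-- no rule with q_1 or q_5, so it is q_7 or at least q_10.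
Isolated : ℕ → Set
Isolated x = 7 ≤ x × x ≢ 8 × x ≢ 9

isolated : ∀ x → 1 ≤ x → (∀ {o} → ¬ Rule 1 x o) → (∀ {o} → ¬ Rule 5 x o) → Isolated x
isolated 1 _ ¬r1 _ = ⊥-elim (¬r1 r3a)
isolated 2 _ ¬r1 _ = ⊥-elim (¬r1 r1a)
isolated 3 _ ¬r1 _ = ⊥-elim (¬r1 r5)
isolated 4 _ ¬r1 _ = ⊥-elim (¬r1 r4a₁)
isolated 5 _ _ ¬r5 = ⊥-elim (¬r5 r3e)
isolated 6 _ _ ¬r5 = ⊥-elim (¬r5 (r1b 5 (≤ᵇ⇒≤ 2 5 tt)))
isolated 7 _ _ _   = ≤-refl , (λ ()) , (λ ())
isolated 8 _ _ ¬r5 = ⊥-elim (¬r5 r4c₂)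
isolated 9 _ _ ¬r5 = ⊥-elim (¬r5 (r2b 5 (≤ᵇ⇒≤ 2 5 tt)))
isolated (suc (suc (suc (suc (suc (suc (suc (suc (suc (suc k)))))))))) _ _ _ =
  ≤-trans (≤ᵇ⇒≤ 7 10 tt) (m≤m+n 10 k) , (λ ()) , (λ ())

ordinary-move : ∀ {p a b o rs} → p ↭ a ∷ b ∷ rs → Rule a b o → OrdinaryMove p (o ++ rs)
ordinary-move P r = _ , _ , _ , _ , r , P , ↭-refl

AfterTwoA : Position → Set
AfterTwoA p = ∃[ L ] p ↭ 2 ∷ 4 ∷ L × All Isolated L × EveryPair Far L

-- Since (2a) requires that no other move is possible, the indices beside
-- q_1, q_5 are isolated and pairwise far.
after-two-a : ∀ {p p'} → All (1 ≤_) p → Move2a p p' → AfterTwoA p'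
after-two-a pos (stuck , rest , P , P') = rest , P' , isolated-rest , far-rest
  where
    positive-rest : All (1 ≤_) rest
    positive-rest with All-resp-↭ P pos
    ... | _ ∷ _ ∷ ps = ps
    isolated-rest : All Isolated rest
    isolated-rest = all-from-front λ {x} R → isolated x (all-front positive-rest R)
      (λ r → stuck _ (ordinary-move (↭-trans P (prep 1 (↭-trans (prep 5 R) (swap 5 x ↭-refl)))) r))
      (λ r → stuck _ (ordinary-move
        (↭-trans P (↭-trans (swap 1 5 ↭-refl) (prep 5 (↭-trans (prep 1 R) (swap 1 x ↭-refl))))) r))
    far-rest : EveryPair Far rest
    far-rest {x} {y} R with far-or-rule x y (proj₁ (all-front isolated-rest R))
                                  (proj₁ (all-front isolated-rest (↭-trans R (swap x y ↭-refl))))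
    ... | inj₁ f = f
    ... | inj₂ (inj₁ (_ , r)) = ⊥-elim (stuck _ (ordinary-move
            (↭-trans P (↭-trans (prep 1 (prep 5 R)) (shifts (1 ∷ 5 ∷ []) (x ∷ y ∷ [])))) r))
    ... | inj₂ (inj₂ (_ , r)) = ⊥-elim (stuck _ (ordinary-move
            (↭-trans P (↭-trans (prep 1 (prep 5 (↭-trans R (swap x y ↭-refl))))
                                (shifts (1 ∷ 5 ∷ []) (y ∷ x ∷ [])))) r))

isolated-far-from-7 : ∀ {m} → Isolated m → Far 7 m → 12 ≤ m
isolated-far-from-7 (7≤m , m≢8 , m≢9) f with (k , refl) ← ≤-offset 7≤m = go k m≢8 m≢9 f
  where
    go : ∀ k → 7 + k ≢ 8 → 7 + k ≢ 9 → Far 7 (7 + k) → 12 ≤ 7 + k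
    go 1 ≢8 _ _ = ⊥-elim (≢8 refl)
    go 2 _ ≢9 _ = ⊥-elim (≢9 refl)
    go (suc (suc (suc (suc (suc k))))) _ _ _ = m≤m+n 12 k

window-of-8 : ∀ {i} → i ≤ 3 → 12 ≤ 8 + suc i → i ≡ 3
window-of-8 {0} _ p = ⊥-elim (≤-refute p tt)
window-of-8 {1} _ p = ⊥-elim (≤-refute p tt)
window-of-8 {2} _ p = ⊥-elim (≤-refute p tt)
window-of-8 {3} _ _ = refl
window-of-8 {suc (suc (suc (suc _)))} i≤3 _ = ⊥-elim (≤-refute i≤3 tt)

first-carry : ∀ {L M} → L ↭ 7 ∷ M → All Isolated L → EveryPair Far L → Good 8 M
first-carry {L} {M} L↭ iso far = record
  { carry-ok      = inj₁ refl
  ; placed        = All.map (λ {m} p → placed-above m p) ≥12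
  ; separated     = far′
  ; one-in-window = at-most-one-in-window {8} (_≡ 3) (λ { refl refl () })
                      (λ i≤3 R → window-of-8 i≤3 (all-front ≥12 R)) far′
  ; no-straddle   = no-straddle-below (λ {x} _ → <⇒≢ (m≤n+m 9 x))
  }
  where
    far′ : EveryPair Far M
    far′ = every-pair-drop far L↭
    ≥12 : All (12 ≤_) M
    ≥12 = all-from-front (λ R →
      isolated-far-from-7 (all-front (proj₂ (all-take iso L↭)) R) (every-pair-with far L↭ R))
    placed-above : ∀ m → 12 ≤ m → Placed 8 m
    placed-above m p with (k , refl) ← ≤-offset p = above (3 + k) refl p

data SmallPart : List ℕ → Set where
  one-two : SmallPart (1 ∷ 2 ∷ [])
  three   : SmallPart (3 ∷ [])

small-≤3 : ∀ {s} → SmallPart s → All (_≤ 3) s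
small-≤3 one-two = ≤ᵇ⇒≤ _ _ tt ∷ ≤ᵇ⇒≤ _ _ tt ∷ []
small-≤3 three   = ≤-refl ∷ []

Carrying : Position → Set
Carrying p = ∃[ s ] ∃[ X ] SmallPart s × p ↭ s ++ X × Carried X

move-after-two-a : ∀ {L a b o rest} → All Isolated L → EveryPair Far L →
                   2 ∷ 4 ∷ L ↭ a ∷ b ∷ rest → Rule a b o →
                   ∃[ M ] L ↭ 7 ∷ M × o ++ rest ↭ 1 ∷ 2 ∷ 8 ∷ M
move-after-two-a {L} iso far P r with pick (2 ∷ 4 ∷ []) L P
... | both-left S _ with pair-take S
...   | inj₁ (refl , refl) = ⊥-elim (no-rule-2-4 r)
...   | inj₂ (refl , refl) = ⊥-elim (no-rule-4-2 r)
move-after-two-a iso far P r | left-right S Q R with b≥7 ← proj₁ (all-front iso Q) | pair-take S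
...   | inj₁ (refl , refl) = ⊥-elim (≤-refute (≤-trans b≥7 (small-rule-bound r (≤ᵇ⇒≤ 2 3 tt))) tt)
...   | inj₂ (refl , refl) with rule-from-4 r
...     | inj₁ (refl , refl) = _ , Q , prep 1 (↭-trans (prep 8 R) (swap 8 2 ↭-refl))
...     | inj₂ (inj₁ b≤5)    = ⊥-elim (≤-refute (≤-trans b≥7 b≤5) tt)
...     | inj₂ (inj₂ refl)   = ⊥-elim (proj₁ (proj₂ (all-front iso Q)) refl)
move-after-two-a iso far P r | right-left Q S _ with a≥7 ← proj₁ (all-front iso Q) | pair-take S
...   | inj₁ (refl , refl) = ⊥-elim (no-rule-down a≥7 (≤-trans (≤ᵇ⇒≤ 3 7 tt) a≥7) r)
...   | inj₂ (refl , refl) = ⊥-elim (no-rule-down a≥7 (≤-trans (≤ᵇ⇒≤ 5 7 tt) a≥7) r)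
move-after-two-a iso far P r | both-right Q _ =
  ⊥-elim (no-rule-far (proj₁ (all-front iso Q)) (far Q) r)

after-two-a-step : ∀ {p p'} → AfterTwoA p → OrdinaryMove p p' → Carrying p'
after-two-a-step (L , P , iso , far) (_ , _ , _ , _ , r , P₁ , P')
  with M , L↭ , Q ← move-after-two-a iso far (↭-trans (↭-sym P) P₁) r =
  1 ∷ 2 ∷ [] , 8 ∷ M , one-two , ↭-trans P' Q , 8 , M , ↭-refl , first-carry L↭ iso far

small-large-no-rule : ∀ {a b o} → a ≤ 3 → 8 ≤ b → ¬ Rule a b o
small-large-no-rule {a} a≤3 b≥8 r =
  ≤-refute (≤-trans b≥8 (≤-trans (small-rule-bound r a≤3) (+-monoˡ-≤ 4 a≤3))) tt

large-small-no-rule : ∀ {a b o} → 8 ≤ a → b ≤ 3 → ¬ Rule a b o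
large-small-no-rule a≥8 b≤3 = no-rule-down (8≤⇒7≤ a≥8) (≤-trans (s≤s b≤3) (≤-trans (≤ᵇ⇒≤ 4 8 tt) a≥8))


small-move : ∀ {s a b s' o} → SmallPart s → s ↭ a ∷ b ∷ s' → Rule a b o →
             ∃[ t ] SmallPart t × (∀ X → o ++ s' ++ X ↭ t ++ X)
small-move three S _ = ⊥-elim (singleton-take₂ S)
small-move one-two S r with pair-take S
... | inj₁ (refl , refl) with refl ← rule-1-2 r = 3 ∷ [] , three , λ _ → ↭-refl
... | inj₂ (refl , refl) = ⊥-elim (no-rule-2-1 r)

carrying-step : ∀ {p p'} → Carrying p → OrdinaryMove p p' → Carrying p'
carrying-step (s , X , sp , P , carried) (a , b , o , rest , r , P₁ , P')
  with pick s X (↭-trans (↭-sym P) P₁)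
... | both-left S R with t , tp , T↭ ← small-move sp S r =
  t , X , tp , ↭-trans P' (↭-trans (++⁺ˡ o R) (T↭ X)) , carried
... | left-right S Q _ =
  ⊥-elim (small-large-no-rule (all-front (small-≤3 sp) S) (all-front (carried-≥8 carried) Q) r)
... | right-left Q S _ =
  ⊥-elim (large-small-no-rule (all-front (carried-≥8 carried) Q) (all-front (small-≤3 sp) S) r)
... | both-right {B'} Q R with (c , M , X↭ , g) ← carried =
  s , o ++ B' , sp , ↭-trans P' (↭-trans (++⁺ˡ o R) (shifts o s)) ,
  large-move g (↭-trans (↭-sym X↭) Q) r

after-two-a-no-5 : ∀ {p} → AfterTwoA p → All (_≢ 5) p
after-two-a-no-5 (L , P , iso , _) =
  All-resp-↭ (↭-sym P) ((λ ()) ∷ (λ ()) ∷ All.map (λ (7≤x , _) x≡5 → ≤-refute (subst (7 ≤_) x≡5 7≤x) tt) iso)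

carrying-no-5 : ∀ {p} → Carrying p → All (_≢ 5) p
carrying-no-5 (s , X , sp , P , carried) = All-resp-↭ (↭-sym P) (AllP.++⁺
  (All.map (λ x≤3 x≡5 → ≤-refute (subst (_≤ 3) x≡5 x≤3) tt) (small-≤3 sp))
  (All.map (λ 8≤x x≡5 → ≤-refute (subst (8 ≤_) x≡5 8≤x) tt) (carried-≥8 carried)))

no-two-a : ∀ {p rest} → All (_≢ 5) p → ¬ (p ↭ 1 ∷ 5 ∷ rest)
no-two-a no5 P with All-resp-↭ P no5
... | _ ∷ 5≢5 ∷ _ = 5≢5 refl

no-second-two-a : ∀ {p p' k} → AfterTwoA p ⊎ Carrying p → Play p p' k → k ≡ 0
no-second-two-a _ done = refl
no-second-two-a (inj₁ st) (ordinary m play) = no-second-two-a (inj₂ (after-two-a-step st m)) play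
no-second-two-a (inj₂ st) (ordinary m play) = no-second-two-a (inj₂ (carrying-step st m)) play
no-second-two-a (inj₁ st) (twoA (_ , _ , P , _) _) = ⊥-elim (no-two-a (after-two-a-no-5 st) P)
no-second-two-a (inj₂ st) (twoA (_ , _ , P , _) _) = ⊥-elim (no-two-a (carrying-no-5 st) P)

ordinary-positive : ∀ {p p'} → All (1 ≤_) p → OrdinaryMove p p' → All (1 ≤_) p'
ordinary-positive pos (_ , _ , _ , rest , r , P , P') with All-resp-↭ P pos
... | _ ∷ _ ∷ pos-rest = All-resp-↭ (↭-sym P') (AllP.++⁺ (rule-outputs-positive r) pos-rest)

at-most-one-two-a : ∀ {p p' k} → All (1 ≤_) p → Play p p' k → k ≤ 1
at-most-one-two-a _   done             = z≤n
at-most-one-two-a pos (ordinary m play) = at-most-one-two-a (ordinary-positive pos m) play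
at-most-one-two-a pos (twoA m play) with refl ← no-second-two-a (inj₁ (after-two-a pos m)) play = ≤-refl

lemma2p2 : (n : ℕ) → n ≥ 1 → (p : Position) (k : ℕ) → Play (initial n) p k → k ≤ 1
lemma2p2 n _ p k play = at-most-one-two-a (AllP.replicate⁺ n ≤-refl) play
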